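{- A formula $\varphi\in\mathrm{PL}(\{\veebar,\wedge,\vee,\mathbin{\dot\vee}\},\Phi)$ is local if and only if it is equivalent to its relaxation $\varphi^{\mathrm{lax}}$.
   Context: A domain $\Phi$ is a finite set of propositional variables (from an infinite supply); a $\Phi$-assignment is a map $s:\Phi\to\{0,1\}$; a $\Phi$-team is a set of $\Phi$-assignments. A split of $T$ is $(T_1,T_2)$ with $T_1,T_2\subseteq T$, $T_1\cup T_2=T$; strict if $T_1\cap T_2=\emptyset$. $\mathrm{PL}(\Sigma,\Phi)$ is the set of formulas built from the literals $\top,\bot,{\sim}\top,{\sim}\bot,p,\neg p,{\sim}p,{\sim}\neg p$ ($p\in\Phi$) by connectives in $\Sigma$. Semantics: $T\models\top$ always; $T\models\bot$ iff $T=\emptyset$; $T\models p$ iff $s(p)=1$ for all $s\in T$; $T\models\neg p$ iff $s(p)=0$ for all $s\in T$; $T\models{\sim}\ell$ iff $T\not\models\ell$; $\wedge$ conjunction; $T\models\psi\veebar\theta$ iff $T\models\psi$ or $T\models\theta$; $T\models\psi\vee\theta$ iff some split $(S,U)$ of $T$ has $S\models\psi$, $U\models\theta$; $\mathbin{\dot\vee}$ likewise with strict splits. For a $\Psi$-team $T$ and $\Phi\subseteq\Psi$, $T\restriction\Phi=\{s\restriction\Phi:s\in T\}$. A formula $\varphi\in\mathrm{PL}(\Sigma,\Phi)$ is local if for every domain $\Psi\supseteq\Phi$ and every $\Psi$-team $T$: $T\models\varphi$ iff $T\restriction\Phi\models\varphi$. Two formulas are equivalent if, for every domain containing all their variables,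 they are satisfied by the same teams. The relaxation $\varphi^{\mathrm{lax}}$ of $\varphi$ is obtained by replacing every occurrence of $\mathbin{\dot\vee}$ by $\vee$. -}

module Defs where

open import Data.Nat using (ℕ; zero; suc)
open import Data.Nat.Properties using (_≟_)
open import Data.Bool using (Bool; true; false; _∧_; _∨_)
open import Data.Bool.Properties using () renaming (_≟_ to _≟ᵇ_)
open import Data.List using (List; []; _∷_; _++_; length; map)
open import Data.Bool.ListAction using (any)
open import Data.Vec using (Vec; []; _∷_)
import Data.Vec.Properties as VecP
open import Data.Product using (Σ; _×_; _,_)
open import Data.Sum using (_⊎_)
open import Data.Empty using (⊥)
open import Data.Unit using () renaming (⊤ to Unit)
open import Relation.Nullary using (¬_; does)
open import Relation.Binary.PropositionalEquality using (_≡_)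
open import Data.List.Relation.Unary.Unique.Propositional using (Unique)
open import Data.List.Relation.Binary.Subset.Propositional using (_⊆_)
open import Function.Bundles using (_⇔_)

Var : Set
Var = ℕ

-- A domain is a finite set of variables: a duplicate-free list.
-- (Uniqueness is imposed where domains are quantified.)
Domain : Set
Domain = List Var

-- A Φ-assignment: one truth value per variable of Φ, in list order.
Assign : Domain → Set
Assign Φ = Vec Bool (length Φ)

-- Value of variable p under a Φ-assignment (false if p ∉ Φ; never used then).
val : (Φ : Domain) → Assign Φ → Var → Bool
val []      []      p = false
val (q ∷ Φ) (b ∷ s) p with does (p ≟ q)
... | true  = b
... | false = val Φ s p

-- A Φ-team: a (finite, decidable) set of Φ-assignments, as a characteristic function.
Team : Domain → Set
Team Φ = Assign Φ → Bool

mem : (Φ : Domain) → Assign Φ → Team Φ → Set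
mem Φ s T = T s ≡ true

IsSplit : (Φ : Domain) → Team Φ → Team Φ → Team Φ → Set
IsSplit Φ T T₁ T₂ =
  ((s : Assign Φ) → mem Φ s T₁ → mem Φ s T) ×
  ((s : Assign Φ) → mem Φ s T₂ → mem Φ s T) ×
  ((s : Assign Φ) → mem Φ s T → (mem Φ s T₁) ⊎ (mem Φ s T₂))

IsStrictSplit : (Φ : Domain) → Team Φ → Team Φ → Team Φ → Set
IsStrictSplit Φ T T₁ T₂ =
  IsSplit Φ T T₁ T₂ × ((s : Assign Φ) → mem Φ s T₁ → ¬ (mem Φ s T₂))

allVecs : (n : ℕ) → List (Vec Bool n)
allVecs zero    = [] ∷ []
allVecs (suc n) = map (true ∷_) (allVecs n) ++ map (false ∷_) (allVecs n)

restrictA : (Ψ Φ : Domain) → Assign Ψ → Assign Φ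
restrictA Ψ []      s = []
restrictA Ψ (p ∷ Φ) s = val Ψ s p ∷ restrictA Ψ Φ s

restrictT : (Ψ Φ : Domain) → Team Ψ → Team Φ
restrictT Ψ Φ T t =
  any (λ s → T s ∧ does (VecP.≡-dec _≟ᵇ_ (restrictA Ψ Φ s) t)) (allVecs (length Ψ))

data Formula : Set where
  top bot ntop nbot : Formula          -- ⊤, ⊥, ∼⊤, ∼⊥
  pos neg npos nneg : Var → Formula    -- p, ¬p, ∼p, ∼¬p
  _⊻_  : Formula → Formula → Formula   -- Boolean disjunction
  _∧F_ : Formula → Formula → Formula
  _∨F_ : Formula → Formula → Formula
  _∨̇_  : Formula → Formula → Formula

vars : Formula → List Var
vars top = []
vars bot = []
vars ntop = []
vars nbot = []
vars (pos p) = p ∷ []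
vars (neg p) = p ∷ []
vars (npos p) = p ∷ []
vars (nneg p) = p ∷ []
vars (φ ⊻ ψ) = vars φ ++ vars ψ
vars (φ ∧F ψ) = vars φ ++ vars ψ
vars (φ ∨F ψ) = vars φ ++ vars ψ
vars (φ ∨̇ ψ) = vars φ ++ vars ψ

sat : (Φ : Domain) → Team Φ → Formula → Set
sat Φ T top = Unit
sat Φ T bot = (s : Assign Φ) → ¬ (mem Φ s T)
sat Φ T ntop = ¬ Unit
sat Φ T nbot = ¬ ((s : Assign Φ) → ¬ (mem Φ s T))
sat Φ T (pos p) = (s : Assign Φ) → mem Φ s T → val Φ s p ≡ true
sat Φ T (neg p) = (s : Assign Φ) → mem Φ s T → val Φ s p ≡ false
sat Φ T (npos p) = ¬ ((s : Assign Φ) → mem Φ s T → val Φ s p ≡ true)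
sat Φ T (nneg p) = ¬ ((s : Assign Φ) → mem Φ s T → val Φ s p ≡ false)
sat Φ T (φ ⊻ ψ) = (sat Φ T φ) ⊎ (sat Φ T ψ)
sat Φ T (φ ∧F ψ) = (sat Φ T φ) × (sat Φ T ψ)
sat Φ T (φ ∨F ψ) =
  Σ (Team Φ) λ S → Σ (Team Φ) λ U → IsSplit Φ T S U × (sat Φ S φ) × (sat Φ U ψ)
sat Φ T (φ ∨̇ ψ) =
  Σ (Team Φ) λ S → Σ (Team Φ) λ U → IsStrictSplit Φ T S U × (sat Φ S φ) × (sat Φ U ψ)

lax : Formula → Formula
lax (φ ⊻ ψ) = lax φ ⊻ lax ψ
lax (φ ∧F ψ) = lax φ ∧F lax ψ
lax (φ ∨F ψ) = lax φ ∨F lax ψ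
lax (φ ∨̇ ψ) = lax φ ∨F lax ψ
lax φ = φ

Local : Domain → Formula → Set
Local Φ φ = (Ψ : Domain) → Unique Ψ → Φ ⊆ Ψ → (T : Team Ψ) →
  sat Ψ T φ ⇔ sat Φ (restrictT Ψ Φ T) φ

Equivalent : Formula → Formula → Set
Equivalent φ ψ = (Ψ : Domain) → Unique Ψ → vars φ ⊆ Ψ → vars ψ ⊆ Ψ →
  (T : Team Ψ) → sat Ψ T φ ⇔ sat Ψ T ψ

module Submission where

-- Relaxing ∨̇ to ∨ only makes a formula easier to satisfy, and satisfaction
-- transfers forward along any map of teams that preserves the variables of the
-- formula, provided the map is injective on the team or the formula has no
-- strict disjunctions (images of strict splits stay disjoint only under
-- injectivity). Conversely, a lax split of T lifts to a strict split of any team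
-- mapping onto T that has a spare free variable: assignments whose image lies in
-- both halves are sent left or right according to that variable.
--
-- So if φ ≡ φ^lax, then φ is local because φ^lax is. If φ is local and T ⊨ φ^lax,
-- let T₂ be the copy of T over Ψ ∪ Φ (constant outside Ψ) and T₁ the cylinder
-- over T₂ adding one fresh free variable per strict disjunction of φ. Then
-- T₁ ⊨ φ; since T₁ and T₂ have the same restriction to Φ, locality gives T₂ ⊨ φ,
-- and T₂ → T is injective, so T ⊨ φ.

open import Defs
open import Data.Bool using (Bool; true; false; _∧_; _∨_; not; if_then_else_)
open import Data.Bool.Properties using (T-≡) renaming (_≟_ to _≟ᵇ_)
open import Data.Bool.ListAction using (any)
open import Data.List using (List; []; _∷_; _++_; length; map; filter; applyUpTo)
open import Data.Nat.ListAction using (sum)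
open import Data.List.Properties using (length-applyUpTo)
open import Data.List.Membership.Propositional using (_∈_; lose)
open import Data.List.Membership.Propositional.Properties
  using (∈-++⁺ˡ; ∈-++⁺ʳ; ∈-map⁺; ∈-filter⁺; ∈-filter⁻; ∈-applyUpTo⁻)
open import Data.List.Relation.Binary.Disjoint.Propositional using (Disjoint)
open import Data.List.Relation.Binary.Subset.Propositional using (_⊆_)
open import Data.List.Relation.Unary.Any using (here; there; satisfied)
open import Data.List.Relation.Unary.Any.Properties using (any⁺; any⁻)
import Data.List.Relation.Unary.All as All
open import Data.List.Relation.Unary.AllPairs using ([]; _∷_)
open import Data.List.Relation.Unary.Unique.Propositional using (Unique)
open import Data.List.Relation.Unary.Unique.Propositional.Properties
  using (++⁺; filter⁺; applyUpTo⁺₁)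
open import Data.Nat using (ℕ; zero; suc; _+_; _≤_; s≤s)
import Data.Nat.Properties as ℕ
open import Data.List.Membership.DecPropositional ℕ._≟_ using (_∈?_)
open import Data.Product using (∃; _×_; _,_; proj₁; proj₂)
import Data.Product as Product
open import Data.Sum using (_⊎_; inj₁; inj₂)
import Data.Sum as Sum
open import Data.Vec using (Vec; []; _∷_)
import Data.Vec.Properties as Vec
open import Function using (_∘_; id)
open import Function.Bundles using (_⇔_; mk⇔; Equivalence)
import Function.Properties.Equivalence as ⇔
open import Relation.Nullary using (¬_; does; yes; no; ¬?)
open import Relation.Nullary.Decidable using (dec-true; dec-false; isYes≗does; toWitness)
open import Relation.Binary.PropositionalEquality

-- Assignments

val-here : ∀ q Θ b (s : Assign Θ) → val (q ∷ Θ) (b ∷ s) q ≡ b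
val-here q Θ b s rewrite dec-true (q ℕ.≟ q) refl = refl

val-there : ∀ {p q} Θ b (s : Assign Θ) → p ≢ q → val (q ∷ Θ) (b ∷ s) p ≡ val Θ s p
val-there {p} {q} Θ b s p≢q rewrite dec-false (p ℕ.≟ q) p≢q = refl

fromValuation : (Θ : Domain) → (Var → Bool) → Assign Θ
fromValuation []      g = []
fromValuation (q ∷ Θ) g = g q ∷ fromValuation Θ g

val-fromValuation : ∀ Θ g {p} → p ∈ Θ → val Θ (fromValuation Θ g) p ≡ g p
val-fromValuation (q ∷ Θ) g (here refl) = val-here q Θ (g q) (fromValuation Θ g)
val-fromValuation (q ∷ Θ) g {p} (there p∈Θ) with p ℕ.≟ q
... | yes refl = val-here q Θ (g q) (fromValuation Θ g)
... | no p≢q   = trans (val-there Θ (g q) _ p≢q) (val-fromValuation Θ g p∈Θ)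

restrictA≡fromValuation : ∀ Ψ Θ (s : Assign Ψ) → restrictA Ψ Θ s ≡ fromValuation Θ (val Ψ s)
restrictA≡fromValuation Ψ []      s = refl
restrictA≡fromValuation Ψ (p ∷ Θ) s = cong (val Ψ s p ∷_) (restrictA≡fromValuation Ψ Θ s)

val-restrictA : ∀ Ψ Θ (s : Assign Ψ) {p} → p ∈ Θ → val Θ (restrictA Ψ Θ s) p ≡ val Ψ s p
val-restrictA Ψ Θ s {p} p∈Θ = begin
  val Θ (restrictA Ψ Θ s) p           ≡⟨ cong (λ t → val Θ t p) (restrictA≡fromValuation Ψ Θ s) ⟩
  val Θ (fromValuation Θ (val Ψ s)) p ≡⟨ val-fromValuation Θ (val Ψ s) p∈Θ ⟩
  val Ψ s p                           ∎
  where open ≡-Reasoning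

restrictA-cong : ∀ Ψ Ψ' Θ (s : Assign Ψ) (s' : Assign Ψ') →
  (∀ {p} → p ∈ Θ → val Ψ s p ≡ val Ψ' s' p) → restrictA Ψ Θ s ≡ restrictA Ψ' Θ s'
restrictA-cong Ψ Ψ' []      s s' agree = refl
restrictA-cong Ψ Ψ' (p ∷ Θ) s s' agree =
  cong₂ _∷_ (agree (here refl)) (restrictA-cong Ψ Ψ' Θ s s' (agree ∘ there))

val-injective : ∀ Θ → Unique Θ → (s s' : Assign Θ) →
  (∀ {p} → p ∈ Θ → val Θ s p ≡ val Θ s' p) → s ≡ s'
val-injective []      []          []      []        agree = refl
val-injective (q ∷ Θ) (q∉Θ ∷ uΘ) (b ∷ s) (b' ∷ s') agree = cong₂ _∷_ b≡b' s≡s'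
  where
  b≡b' : b ≡ b'
  b≡b' = trans (sym (val-here q Θ b s)) (trans (agree (here refl)) (val-here q Θ b' s'))
  s≡s' : s ≡ s'
  s≡s' = val-injective Θ uΘ s s' λ p∈Θ →
    let p≢q = All.lookup q∉Θ p∈Θ ∘ sym in
    trans (sym (val-there Θ b s p≢q)) (trans (agree (there p∈Θ)) (val-there Θ b' s' p≢q))

restrictA-restrictA : ∀ Ψ Θ Φ → Φ ⊆ Θ → (s : Assign Ψ) →
  restrictA Θ Φ (restrictA Ψ Θ s) ≡ restrictA Ψ Φ s
restrictA-restrictA Ψ Θ Φ Φ⊆Θ s =
  restrictA-cong Θ Ψ Φ _ s λ p∈Φ → val-restrictA Ψ Θ s (Φ⊆Θ p∈Φ)

restrictA-extension : ∀ Ψ Θ → Unique Θ → Θ ⊆ Ψ → (t : Assign Θ) →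
  restrictA Ψ Θ (fromValuation Ψ (val Θ t)) ≡ t
restrictA-extension Ψ Θ uΘ Θ⊆Ψ t = val-injective Θ uΘ _ t λ p∈Θ →
  trans (val-restrictA Ψ Θ _ p∈Θ) (val-fromValuation Ψ (val Θ t) (Θ⊆Ψ p∈Θ))

update : (Var → Bool) → Var → Bool → Var → Bool
update g q b p = if does (p ℕ.≟ q) then b else g p

update-same : ∀ g q b → update g q b q ≡ b
update-same g q b rewrite dec-true (q ℕ.≟ q) refl = refl

update-other : ∀ g {q} b {p} → p ≢ q → update g q b p ≡ g p
update-other g {q} b {p} p≢q rewrite dec-false (p ℕ.≟ q) p≢q = refl

-- Strict disjunctions and relaxation

strictCount : Formula → ℕ
strictCount (a ⊻ b)  = strictCount a + strictCount b
strictCount (a ∧F b) = strictCount a + strictCount b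
strictCount (a ∨F b) = strictCount a + strictCount b
strictCount (a ∨̇ b)  = suc (strictCount a + strictCount b)
strictCount _        = 0

strictCount-lax : ∀ ψ → strictCount (lax ψ) ≡ 0
strictCount-lax top      = refl
strictCount-lax bot      = refl
strictCount-lax ntop     = refl
strictCount-lax nbot     = refl
strictCount-lax (pos p)  = refl
strictCount-lax (neg p)  = refl
strictCount-lax (npos p) = refl
strictCount-lax (nneg p) = refl
strictCount-lax (a ⊻ b)  = cong₂ _+_ (strictCount-lax a) (strictCount-lax b)
strictCount-lax (a ∧F b) = cong₂ _+_ (strictCount-lax a) (strictCount-lax b)
strictCount-lax (a ∨F b) = cong₂ _+_ (strictCount-lax a) (strictCount-lax b)
strictCount-lax (a ∨̇ b)  = cong₂ _+_ (strictCount-lax a) (strictCount-lax b)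

vars-lax : ∀ ψ → vars (lax ψ) ≡ vars ψ
vars-lax top      = refl
vars-lax bot      = refl
vars-lax ntop     = refl
vars-lax nbot     = refl
vars-lax (pos p)  = refl
vars-lax (neg p)  = refl
vars-lax (npos p) = refl
vars-lax (nneg p) = refl
vars-lax (a ⊻ b)  = cong₂ _++_ (vars-lax a) (vars-lax b)
vars-lax (a ∧F b) = cong₂ _++_ (vars-lax a) (vars-lax b)
vars-lax (a ∨F b) = cong₂ _++_ (vars-lax a) (vars-lax b)
vars-lax (a ∨̇ b)  = cong₂ _++_ (vars-lax a) (vars-lax b)

sat⇒sat-lax : ∀ Θ T ψ → sat Θ T ψ → sat Θ T (lax ψ)
sat⇒sat-lax Θ T top      h = h
sat⇒sat-lax Θ T bot      h = h
sat⇒sat-lax Θ T ntop     h = h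
sat⇒sat-lax Θ T nbot     h = h
sat⇒sat-lax Θ T (pos p)  h = h
sat⇒sat-lax Θ T (neg p)  h = h
sat⇒sat-lax Θ T (npos p) h = h
sat⇒sat-lax Θ T (nneg p) h = h
sat⇒sat-lax Θ T (a ⊻ b)  h = Sum.map (sat⇒sat-lax Θ T a) (sat⇒sat-lax Θ T b) h
sat⇒sat-lax Θ T (a ∧F b) (hᵃ , hᵇ) = sat⇒sat-lax Θ T a hᵃ , sat⇒sat-lax Θ T b hᵇ
sat⇒sat-lax Θ T (a ∨F b) (S , U , split , hᵃ , hᵇ) =
  S , U , split , sat⇒sat-lax Θ S a hᵃ , sat⇒sat-lax Θ U b hᵇ
sat⇒sat-lax Θ T (a ∨̇ b)  (S , U , (split , _) , hᵃ , hᵇ) =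
  S , U , split , sat⇒sat-lax Θ S a hᵃ , sat⇒sat-lax Θ U b hᵇ

-- x and u say whether an image lies in either half of a lax split, v is a spare
-- variable deciding on which side images lying in both halves go.

leftPart rightPart : Bool → Bool → Bool → Bool
leftPart  x u v = x ∧ (not u ∨ not v)
rightPart x u v = u ∧ (not x ∨ v)

parts-cover : ∀ x u v → x ≡ true ⊎ u ≡ true → leftPart x u v ≡ true ⊎ rightPart x u v ≡ true
parts-cover true  true  true  _ = inj₂ refl
parts-cover true  true  false _ = inj₁ refl
parts-cover true  false v     _ = inj₁ refl
parts-cover false true  v     _ = inj₂ refl
parts-cover false false v     (inj₁ ())
parts-cover false false v     (inj₂ ())

parts-disjoint : ∀ x u v → leftPart x u v ≡ true → ¬ rightPart x u v ≡ true
parts-disjoint true  true  true  ()  _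
parts-disjoint true  true  false _   ()
parts-disjoint true  false v     _   ()
parts-disjoint false u     v     ()  _

leftPart-false : ∀ {x} u → x ≡ true → leftPart x u false ≡ true
leftPart-false true  refl = refl
leftPart-false false refl = refl

rightPart-true : ∀ x {u} → u ≡ true → rightPart x u true ≡ true
rightPart-true true  refl = refl
rightPart-true false refl = refl

-- Teams and their images under maps of assignments

∧-true⁻ : ∀ {a b} → a ∧ b ≡ true → a ≡ true × b ≡ true
∧-true⁻ {true} {true} _ = refl , refl

∧-true⁺ : ∀ {a b} → a ≡ true → b ≡ true → a ∧ b ≡ true
∧-true⁺ refl refl = refl

any-witness : ∀ {A : Set} (P : A → Bool) xs → any P xs ≡ true → ∃ λ x → P x ≡ true
any-witness P xs =
  Product.map₂ (Equivalence.to T-≡) ∘ satisfied ∘ any⁻ P xs ∘ Equivalence.from T-≡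

any-intro : ∀ {A : Set} (P : A → Bool) {x xs} → x ∈ xs → P x ≡ true → any P xs ≡ true
any-intro P x∈xs Px = Equivalence.to T-≡ (any⁺ P (lose x∈xs (Equivalence.from T-≡ Px)))

∈-allVecs : ∀ n (v : Vec Bool n) → v ∈ allVecs n
∈-allVecs zero    []          = here refl
∈-allVecs (suc n) (true ∷ v)  = ∈-++⁺ˡ (∈-map⁺ (true ∷_) (∈-allVecs n v))
∈-allVecs (suc n) (false ∷ v) =
  ∈-++⁺ʳ (map (true ∷_) (allVecs n)) (∈-map⁺ (false ∷_) (∈-allVecs n v))

SubTeam : (Θ : Domain) → Team Θ → Team Θ → Set
SubTeam Θ S T = (s : Assign Θ) → mem Θ s S → mem Θ s T

module _ (Ψ' Ψ : Domain) (f : Assign Ψ' → Assign Ψ) where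

  IsImage : Team Ψ' → Team Ψ → Set
  IsImage T' T = ((s : Assign Ψ') → mem Ψ' s T' → mem Ψ (f s) T) ×
                 ((t : Assign Ψ) → mem Ψ t T → ∃ λ s → mem Ψ' s T' × f s ≡ t)

  InjectiveOn : Team Ψ' → Set
  InjectiveOn T' = ∀ s₁ s₂ → mem Ψ' s₁ T' → mem Ψ' s₂ T' → f s₁ ≡ f s₂ → s₁ ≡ s₂

  AgreesOn : List Var → Set
  AgreesOn V = ∀ {p} → p ∈ V → (s : Assign Ψ') → val Ψ (f s) p ≡ val Ψ' s p

  Free : List Var → Team Ψ' → Set
  Free Q T' = ∀ {q} → q ∈ Q → ∀ s → mem Ψ' s T' → ∀ b →
    ∃ λ s' → mem Ψ' s' T' × f s' ≡ f s × val Ψ' s' q ≡ b ×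
             (∀ {r} → r ∈ Q → r ≢ q → val Ψ' s' r ≡ val Ψ' s r)

  image : Team Ψ' → Team Ψ
  image S t = any (λ s → S s ∧ does (Vec.≡-dec _≟ᵇ_ (f s) t)) (allVecs (length Ψ'))

  image⁻ : ∀ {S t} → mem Ψ t (image S) → ∃ λ s → mem Ψ' s S × f s ≡ t
  image⁻ {S} {t} t∈ with any-witness _ (allVecs (length Ψ')) t∈
  ... | s , s∈∧fs≡t with ∧-true⁻ {S s} s∈∧fs≡t
  ...   | s∈ , fs≡t =
    s , s∈ , toWitness (Equivalence.from T-≡ (trans (isYes≗does (Vec.≡-dec _≟ᵇ_ (f s) t)) fs≡t))

  image⁺ : ∀ {S s} → mem Ψ' s S → mem Ψ (f s) (image S)
  image⁺ {S} {s} s∈ = any-intro _ (∈-allVecs (length Ψ') s)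
    (∧-true⁺ s∈ (dec-true (Vec.≡-dec _≟ᵇ_ (f s) (f s)) refl))

  image-isImage : ∀ S → IsImage S (image S)
  image-isImage S = (λ s → image⁺) , (λ t → image⁻)

  image-split : ∀ {T' T S' U'} → IsImage T' T → IsSplit Ψ' T' S' U' →
    IsSplit Ψ T (image S') (image U')
  image-split {T'} {T} {S'} {U'} (into , onto) (S'⊆T' , U'⊆T' , cover) =
    image-⊆ S'⊆T' , image-⊆ U'⊆T' , image-cover
    where
    image-⊆ : ∀ {S'} → SubTeam Ψ' S' T' → SubTeam Ψ (image S') T
    image-⊆ S'⊆T' t t∈ with image⁻ t∈
    ... | s , s∈ , refl = into s (S'⊆T' s s∈)
    image-cover : ∀ t → mem Ψ t T → mem Ψ t (image S') ⊎ mem Ψ t (image U')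
    image-cover t t∈ with onto t t∈
    ... | s , s∈ , refl = Sum.map image⁺ image⁺ (cover s s∈)

  image-disjoint : ∀ {T' S' U'} → InjectiveOn T' → SubTeam Ψ' S' T' → SubTeam Ψ' U' T' →
    (∀ s → mem Ψ' s S' → ¬ mem Ψ' s U') →
    ∀ t → mem Ψ t (image S') → ¬ mem Ψ t (image U')
  image-disjoint inj S'⊆T' U'⊆T' disjoint t t∈S t∈U with image⁻ t∈S | image⁻ t∈U
  ... | s₁ , s₁∈ , refl | s₂ , s₂∈ , fs₂≡fs₁
    with inj s₂ s₁ (U'⊆T' s₂ s₂∈) (S'⊆T' s₁ s₁∈) fs₂≡fs₁
  ...   | refl = disjoint s₁ s₁∈ s₂∈

  injectiveOn-⊆ : ∀ {S' T'} → SubTeam Ψ' S' T' → InjectiveOn T' → InjectiveOn S'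
  injectiveOn-⊆ S'⊆T' inj s₁ s₂ s₁∈ s₂∈ = inj s₁ s₂ (S'⊆T' s₁ s₁∈) (S'⊆T' s₂ s₂∈)

  agreesOn-++ˡ : ∀ {V W} → AgreesOn (V ++ W) → AgreesOn V
  agreesOn-++ˡ agree = agree ∘ ∈-++⁺ˡ

  agreesOn-++ʳ : ∀ V {W} → AgreesOn (V ++ W) → AgreesOn W
  agreesOn-++ʳ V agree = agree ∘ ∈-++⁺ʳ V

  narrowˡ : ∀ a b {S' T'} → SubTeam Ψ' S' T' →
    InjectiveOn T' ⊎ strictCount a + strictCount b ≡ 0 → InjectiveOn S' ⊎ strictCount a ≡ 0
  narrowˡ a b S'⊆T' = Sum.map (injectiveOn-⊆ S'⊆T') (ℕ.m+n≡0⇒m≡0 (strictCount a))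

  narrowʳ : ∀ a b {S' T'} → SubTeam Ψ' S' T' →
    InjectiveOn T' ⊎ strictCount a + strictCount b ≡ 0 → InjectiveOn S' ⊎ strictCount b ≡ 0
  narrowʳ a b S'⊆T' = Sum.map (injectiveOn-⊆ S'⊆T') (ℕ.m+n≡0⇒n≡0 (strictCount a))

  sat-image : ∀ ψ {T' T} → InjectiveOn T' ⊎ strictCount ψ ≡ 0 → AgreesOn (vars ψ) →
    IsImage T' T → sat Ψ' T' ψ → sat Ψ T ψ
  sat-image top  _ _ _ h = h
  sat-image ntop _ _ _ h = h
  sat-image bot  _ _ (_ , onto) h t t∈ with onto t t∈
  ... | s , s∈ , _ = h s s∈
  sat-image nbot _ _ (into , _) h H = h λ s s∈ → H (f s) (into s s∈)
  sat-image (pos p) _ agree (_ , onto) h t t∈ with onto t t∈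
  ... | s , s∈ , refl = trans (agree (here refl) s) (h s s∈)
  sat-image (neg p) _ agree (_ , onto) h t t∈ with onto t t∈
  ... | s , s∈ , refl = trans (agree (here refl) s) (h s s∈)
  sat-image (npos p) _ agree (into , _) h H =
    h λ s s∈ → trans (sym (agree (here refl) s)) (H (f s) (into s s∈))
  sat-image (nneg p) _ agree (into , _) h H =
    h λ s s∈ → trans (sym (agree (here refl) s)) (H (f s) (into s s∈))
  sat-image (a ⊻ b) c agree img = Sum.map
    (sat-image a (narrowˡ a b (λ _ → id) c) (agreesOn-++ˡ agree) img)
    (sat-image b (narrowʳ a b (λ _ → id) c) (agreesOn-++ʳ (vars a) agree) img)
  sat-image (a ∧F b) c agree img (hᵃ , hᵇ) =
    sat-image a (narrowˡ a b (λ _ → id) c) (agreesOn-++ˡ agree) img hᵃ ,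
    sat-image b (narrowʳ a b (λ _ → id) c) (agreesOn-++ʳ (vars a) agree) img hᵇ
  sat-image (a ∨F b) c agree img (S' , U' , split@(S'⊆T' , U'⊆T' , _) , hᵃ , hᵇ) =
    image S' , image U' , image-split img split ,
    sat-image a (narrowˡ a b S'⊆T' c) (agreesOn-++ˡ agree) (image-isImage S') hᵃ ,
    sat-image b (narrowʳ a b U'⊆T' c) (agreesOn-++ʳ (vars a) agree) (image-isImage U') hᵇ
  sat-image (a ∨̇ b) (inj₁ inj) agree img
            (S' , U' , (split@(S'⊆T' , U'⊆T' , _) , disjoint) , hᵃ , hᵇ) =
    image S' , image U' , (image-split img split , image-disjoint inj S'⊆T' U'⊆T' disjoint) ,
    sat-image a (inj₁ (injectiveOn-⊆ S'⊆T' inj)) (agreesOn-++ˡ agree) (image-isImage S') hᵃ ,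
    sat-image b (inj₁ (injectiveOn-⊆ U'⊆T' inj)) (agreesOn-++ʳ (vars a) agree) (image-isImage U') hᵇ

  preimage : Team Ψ' → Team Ψ → Team Ψ'
  preimage T' S s = T' s ∧ S (f s)

  preimage-isImage : ∀ {T' T S} → IsImage T' T → SubTeam Ψ S T → IsImage (preimage T' S) S
  preimage-isImage {T'} {T} {S} (_ , onto) S⊆T = (λ s s∈ → proj₂ (∧-true⁻ {T' s} s∈)) , onto'
    where
    onto' : ∀ t → mem Ψ t S → ∃ λ s → mem Ψ' s (preimage T' S) × f s ≡ t
    onto' t t∈ with onto t (S⊆T t t∈)
    ... | s , s∈ , refl = s , ∧-true⁺ s∈ t∈ , refl

  preimage-split : ∀ {T' T S U} → IsImage T' T → IsSplit Ψ T S U →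
    IsSplit Ψ' T' (preimage T' S) (preimage T' U)
  preimage-split {T'} (into , _) (_ , _ , cover) =
    (λ s → proj₁ ∘ ∧-true⁻ {T' s}) , (λ s → proj₁ ∘ ∧-true⁻ {T' s}) ,
    λ s s∈ → Sum.map (∧-true⁺ s∈) (∧-true⁺ s∈) (cover (f s) (into s s∈))

  preimage-free : ∀ {Q T' S} → Free Q T' → Free Q (preimage T' S)
  preimage-free {T' = T'} {S} free q∈Q s s∈ b with ∧-true⁻ {T' s} s∈
  ... | s∈T' , fs∈S with free q∈Q s s∈T' b
  ...   | s' , s'∈T' , fs'≡fs , rest =
    s' , ∧-true⁺ s'∈T' (subst (λ t → S t ≡ true) (sym fs'≡fs) fs∈S) , fs'≡fs , rest

  splitBy : (Bool → Bool → Bool → Bool) → Var → Team Ψ' → Team Ψ → Team Ψ → Team Ψ'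
  splitBy part q T' S U s = T' s ∧ part (S (f s)) (U (f s)) (val Ψ' s q)

  splitBy-strictSplit : ∀ q {T' T S U} → IsImage T' T → IsSplit Ψ T S U →
    IsStrictSplit Ψ' T' (splitBy leftPart q T' S U) (splitBy rightPart q T' S U)
  splitBy-strictSplit q {T'} {T} {S} {U} (into , _) (_ , _ , cover) =
    ((λ s → proj₁ ∘ ∧-true⁻ {T' s}) , (λ s → proj₁ ∘ ∧-true⁻ {T' s}) , cover') , disjoint
    where
    cover' : ∀ s → mem Ψ' s T' →
      mem Ψ' s (splitBy leftPart q T' S U) ⊎ mem Ψ' s (splitBy rightPart q T' S U)
    cover' s s∈ = Sum.map (∧-true⁺ s∈) (∧-true⁺ s∈)
      (parts-cover (S (f s)) (U (f s)) (val Ψ' s q) (cover (f s) (into s s∈)))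
    disjoint : ∀ s → mem Ψ' s (splitBy leftPart q T' S U) → ¬ mem Ψ' s (splitBy rightPart q T' S U)
    disjoint s s∈ˡ s∈ʳ = parts-disjoint (S (f s)) (U (f s)) (val Ψ' s q)
      (proj₂ (∧-true⁻ {T' s} s∈ˡ)) (proj₂ (∧-true⁻ {T' s} s∈ʳ))

  splitBy-isImageˡ : ∀ {q Q T' T S U} → IsImage T' T → IsSplit Ψ T S U → Free (q ∷ Q) T' →
    IsImage (splitBy leftPart q T' S U) S
  splitBy-isImageˡ {q} {Q} {T'} {T} {S} {U} (_ , onto) (S⊆T , _) free = into' , onto'
    where
    into' : ∀ s → mem Ψ' s (splitBy leftPart q T' S U) → mem Ψ (f s) S
    into' s s∈ = proj₁ (∧-true⁻ {S (f s)} (proj₂ (∧-true⁻ {T' s} s∈)))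
    onto' : ∀ t → mem Ψ t S → ∃ λ s → mem Ψ' s (splitBy leftPart q T' S U) × f s ≡ t
    onto' t t∈ with onto t (S⊆T t t∈)
    ... | s₀ , s₀∈ , refl with free (here refl) s₀ s₀∈ false
    ...   | s , s∈ , fs≡fs₀ , sq≡false , _ = s , ∧-true⁺ s∈ in-part , fs≡fs₀
      where
      in-part : leftPart (S (f s)) (U (f s)) (val Ψ' s q) ≡ true
      in-part = subst₂ (λ t v → leftPart (S t) (U t) v ≡ true) (sym fs≡fs₀) (sym sq≡false)
        (leftPart-false (U (f s₀)) t∈)

  splitBy-isImageʳ : ∀ {q Q T' T S U} → IsImage T' T → IsSplit Ψ T S U → Free (q ∷ Q) T' →
    IsImage (splitBy rightPart q T' S U) U
  splitBy-isImageʳ {q} {Q} {T'} {T} {S} {U} (_ , onto) (_ , U⊆T , _) free = into' , onto'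
    where
    into' : ∀ s → mem Ψ' s (splitBy rightPart q T' S U) → mem Ψ (f s) U
    into' s s∈ = proj₁ (∧-true⁻ {U (f s)} (proj₂ (∧-true⁻ {T' s} s∈)))
    onto' : ∀ t → mem Ψ t U → ∃ λ s → mem Ψ' s (splitBy rightPart q T' S U) × f s ≡ t
    onto' t t∈ with onto t (U⊆T t t∈)
    ... | s₀ , s₀∈ , refl with free (here refl) s₀ s₀∈ true
    ...   | s , s∈ , fs≡fs₀ , sq≡true , _ = s , ∧-true⁺ s∈ in-part , fs≡fs₀
      where
      in-part : rightPart (S (f s)) (U (f s)) (val Ψ' s q) ≡ true
      in-part = subst₂ (λ t v → rightPart (S t) (U t) v ≡ true) (sym fs≡fs₀) (sym sq≡true)
        (rightPart-true (S (f s₀)) t∈)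

  splitBy-free : ∀ part {q Q T' S U} → All.All (q ≢_) Q → Free (q ∷ Q) T' →
    Free Q (splitBy part q T' S U)
  splitBy-free part {q} {Q} {T'} {S} {U} q∉Q free r∈Q s s∈ b with ∧-true⁻ {T' s} s∈
  ... | s∈T' , s-in-part with free (there r∈Q) s s∈T' b
  ...   | s' , s'∈T' , fs'≡fs , s'r≡b , unchanged =
    s' , ∧-true⁺ s'∈T' in-part , fs'≡fs , s'r≡b , unchanged ∘ there
    where
    in-part : part (S (f s')) (U (f s')) (val Ψ' s' q) ≡ true
    in-part = subst₂ (λ t v → part (S t) (U t) v ≡ true) (sym fs'≡fs)
      (sym (unchanged (here refl) (All.lookup q∉Q r∈Q))) s-in-part

  sat-preimage : ∀ ψ {T' T} Q → Unique Q → strictCount ψ ≤ length Q → AgreesOn (vars ψ) →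
    IsImage T' T → Free Q T' → sat Ψ T (lax ψ) → sat Ψ' T' ψ
  sat-preimage top  _ _ _ _ _ _ h = h
  sat-preimage ntop _ _ _ _ _ _ h = h
  sat-preimage bot  _ _ _ _ (into , _) _ h s s∈ = h (f s) (into s s∈)
  sat-preimage nbot _ _ _ _ (_ , onto) _ h H = h λ t t∈ → let (s , s∈ , _) = onto t t∈ in H s s∈
  sat-preimage (pos p) _ _ _ agree (into , _) _ h s s∈ =
    trans (sym (agree (here refl) s)) (h (f s) (into s s∈))
  sat-preimage (neg p) _ _ _ agree (into , _) _ h s s∈ =
    trans (sym (agree (here refl) s)) (h (f s) (into s s∈))
  sat-preimage (npos p) _ _ _ agree (_ , onto) _ h H = h λ t t∈ →
    let (s , s∈ , fs≡t) = onto t t∈ in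
    subst (λ u → val Ψ u p ≡ true) fs≡t (trans (agree (here refl) s) (H s s∈))
  sat-preimage (nneg p) _ _ _ agree (_ , onto) _ h H = h λ t t∈ →
    let (s , s∈ , fs≡t) = onto t t∈ in
    subst (λ u → val Ψ u p ≡ false) fs≡t (trans (agree (here refl) s) (H s s∈))
  sat-preimage (a ⊻ b) Q uQ le agree img free = Sum.map
    (sat-preimage a Q uQ (ℕ.m+n≤o⇒m≤o _ le) (agreesOn-++ˡ agree) img free)
    (sat-preimage b Q uQ (ℕ.m+n≤o⇒n≤o (strictCount a) le) (agreesOn-++ʳ (vars a) agree) img free)
  sat-preimage (a ∧F b) Q uQ le agree img free (hᵃ , hᵇ) =
    sat-preimage a Q uQ (ℕ.m+n≤o⇒m≤o _ le) (agreesOn-++ˡ agree) img free hᵃ ,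
    sat-preimage b Q uQ (ℕ.m+n≤o⇒n≤o (strictCount a) le) (agreesOn-++ʳ (vars a) agree) img free hᵇ
  sat-preimage (a ∨F b) {T'} Q uQ le agree img free (S , U , split@(S⊆T , U⊆T , _) , hᵃ , hᵇ) =
    preimage T' S , preimage T' U , preimage-split img split ,
    sat-preimage a Q uQ (ℕ.m+n≤o⇒m≤o _ le) (agreesOn-++ˡ agree)
      (preimage-isImage img S⊆T) (preimage-free {S = S} free) hᵃ ,
    sat-preimage b Q uQ (ℕ.m+n≤o⇒n≤o (strictCount a) le) (agreesOn-++ʳ (vars a) agree)
      (preimage-isImage img U⊆T) (preimage-free {S = U} free) hᵇ
  sat-preimage (a ∨̇ b) [] _ () _ _ _ _
  sat-preimage (a ∨̇ b) {T'} (q ∷ Q) (q∉Q ∷ uQ) (s≤s le) agree img free (S , U , split , hᵃ , hᵇ) =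
    splitBy leftPart q T' S U , splitBy rightPart q T' S U , splitBy-strictSplit q img split ,
    sat-preimage a Q uQ (ℕ.m+n≤o⇒m≤o _ le) (agreesOn-++ˡ agree)
      (splitBy-isImageˡ img split free) (splitBy-free leftPart {S = S} {U} q∉Q free) hᵃ ,
    sat-preimage b Q uQ (ℕ.m+n≤o⇒n≤o (strictCount a) le) (agreesOn-++ʳ (vars a) agree)
      (splitBy-isImageʳ img split free) (splitBy-free rightPart {S = S} {U} q∉Q free) hᵇ

isImage-∘ : ∀ Ψ₁ Ψ₂ Ψ₃ {g h T₁ T₂ T₃} → IsImage Ψ₁ Ψ₂ g T₁ T₂ → IsImage Ψ₂ Ψ₃ h T₂ T₃ →
  IsImage Ψ₁ Ψ₃ (h ∘ g) T₁ T₃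
isImage-∘ Ψ₁ Ψ₂ Ψ₃ {g} {h} {T₁} {T₃ = T₃} (intoᵍ , ontoᵍ) (intoʰ , ontoʰ) =
  (λ s s∈ → intoʰ (g s) (intoᵍ s s∈)) , onto
  where
  onto : ∀ t → mem Ψ₃ t T₃ → ∃ λ s → mem Ψ₁ s T₁ × h (g s) ≡ t
  onto t t∈ with ontoʰ t t∈
  ... | u , u∈ , refl with ontoᵍ u u∈
  ...   | s , s∈ , refl = s , s∈ , refl

isImage-unique : ∀ Ψ' Ψ {f g T' T U} → (∀ s → f s ≡ g s) →
  IsImage Ψ' Ψ f T' T → IsImage Ψ' Ψ g T' U → IsImage Ψ Ψ id T U
isImage-unique Ψ' Ψ {f} {g} {T = T} {U} f≗g (intoᶠ , ontoᶠ) (intoᵍ , ontoᵍ) = into , onto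
  where
  into : ∀ t → mem Ψ t T → mem Ψ t U
  into t t∈ with ontoᶠ t t∈
  ... | s , s∈ , refl = subst (λ u → mem Ψ u U) (sym (f≗g s)) (intoᵍ s s∈)
  onto : ∀ t → mem Ψ t U → ∃ λ u → mem Ψ u T × u ≡ t
  onto t t∈ with ontoᵍ t t∈
  ... | s , s∈ , refl = f s , intoᶠ s s∈ , f≗g s

isImage-preimage : ∀ Θ Ψ {g : Assign Θ → Assign Ψ} (h : Assign Ψ → Assign Θ) {T} →
  (∀ t → g (h t) ≡ t) → IsImage Θ Ψ g (T ∘ g) T
isImage-preimage Θ Ψ {g} h {T} g∘h≗id =
  (λ s s∈ → s∈) , λ t t∈ → h t , subst (λ u → mem Ψ u T) (sym (g∘h≗id t)) t∈ , g∘h≗id t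

isImage-image : ∀ Θ Ψ {g : Assign Θ → Assign Ψ} (h : Assign Ψ → Assign Θ) {T} →
  (∀ t → g (h t) ≡ t) → IsImage Θ Ψ g (image Ψ Θ h T) T
isImage-image Θ Ψ {g} h {T} g∘h≗id = into , λ t t∈ → h t , image⁺ Ψ Θ h t∈ , g∘h≗id t
  where
  into : ∀ s → mem Θ s (image Ψ Θ h T) → mem Ψ (g s) T
  into s s∈ with image⁻ Ψ Θ h s∈
  ... | t , t∈ , refl = subst (λ u → mem Ψ u T) (sym (g∘h≗id t)) t∈

injectiveOn-image : ∀ Θ Ψ {g : Assign Θ → Assign Ψ} (h : Assign Ψ → Assign Θ) {T} →
  (∀ t → g (h t) ≡ t) → InjectiveOn Θ Ψ g (image Ψ Θ h T)
injectiveOn-image Θ Ψ {g} h g∘h≗id s₁ s₂ s₁∈ s₂∈ gs₁≡gs₂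
  with image⁻ Ψ Θ h s₁∈ | image⁻ Ψ Θ h s₂∈
... | t₁ , _ , refl | t₂ , _ , refl =
  cong h (trans (sym (g∘h≗id t₁)) (trans gs₁≡gs₂ (g∘h≗id t₂)))

agreesOn-restrictA : ∀ Ψ Θ {V} → V ⊆ Θ → AgreesOn Ψ Θ (restrictA Ψ Θ) V
agreesOn-restrictA Ψ Θ V⊆Θ p∈V s = val-restrictA Ψ Θ s (V⊆Θ p∈V)

agreesOn-∘ : ∀ Ψ₁ Ψ₂ Ψ₃ {g h V} → AgreesOn Ψ₁ Ψ₂ g V → AgreesOn Ψ₂ Ψ₃ h V →
  AgreesOn Ψ₁ Ψ₃ (h ∘ g) V
agreesOn-∘ Ψ₁ Ψ₂ Ψ₃ {g} agreeᵍ agreeʰ p∈V s = trans (agreeʰ p∈V (g s)) (agreeᵍ p∈V s)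

free-cylinder : ∀ Θ F Ψ (h : Assign Θ → Assign Ψ) (T : Team Θ) → Disjoint Θ F →
  Free (Θ ++ F) Ψ (h ∘ restrictA (Θ ++ F) Θ) F (T ∘ restrictA (Θ ++ F) Θ)
free-cylinder Θ F Ψ h T Θ#F {q} q∈F s s∈ b =
  s' , subst (λ u → T u ≡ true) (sym same) s∈ , cong h same , s'q≡b ,
  λ r∈F → s'≡s-off-q (∈-++⁺ʳ Θ r∈F)
  where
  s' : Assign (Θ ++ F)
  s' = fromValuation (Θ ++ F) (update (val (Θ ++ F) s) q b)
  s'q≡b : val (Θ ++ F) s' q ≡ b
  s'q≡b = trans (val-fromValuation (Θ ++ F) _ (∈-++⁺ʳ Θ q∈F)) (update-same (val (Θ ++ F) s) q b)
  s'≡s-off-q : ∀ {r} → r ∈ Θ ++ F → r ≢ q → val (Θ ++ F) s' r ≡ val (Θ ++ F) s r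
  s'≡s-off-q r∈ r≢q = trans (val-fromValuation (Θ ++ F) _ r∈) (update-other (val (Θ ++ F) s) b r≢q)
  same : restrictA (Θ ++ F) Θ s' ≡ restrictA (Θ ++ F) Θ s
  same = restrictA-cong (Θ ++ F) (Θ ++ F) Θ s' s λ r∈Θ →
    s'≡s-off-q (∈-++⁺ˡ r∈Θ) λ { refl → Θ#F (r∈Θ , q∈F) }

-- Extending domains

unique-union : ∀ {Ψ Φ} → Unique Ψ → Unique Φ → ∃ λ Θ → Unique Θ × Ψ ⊆ Θ × Φ ⊆ Θ
unique-union {Ψ} {Φ} uΨ uΦ = Ψ ++ new , ++⁺ uΨ (filter⁺ ∉Ψ? uΦ) disjoint , ∈-++⁺ˡ , Φ⊆
  where
  ∉Ψ? = λ p → ¬? (p ∈? Ψ)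
  new = filter ∉Ψ? Φ
  disjoint : Disjoint Ψ new
  disjoint (p∈Ψ , p∈new) = proj₂ (∈-filter⁻ ∉Ψ? {xs = Φ} p∈new) p∈Ψ
  Φ⊆ : Φ ⊆ Ψ ++ new
  Φ⊆ {p} p∈Φ with p ∈? Ψ
  ... | yes p∈Ψ = ∈-++⁺ˡ p∈Ψ
  ... | no  p∉Ψ = ∈-++⁺ʳ Ψ (∈-filter⁺ ∉Ψ? p∈Φ p∉Ψ)

∈⇒≤sum : ∀ {p xs} → p ∈ xs → p ≤ sum xs
∈⇒≤sum {xs = x ∷ xs} (here refl)  = ℕ.m≤m+n x (sum xs)
∈⇒≤sum {xs = x ∷ xs} (there p∈xs) = ℕ.≤-trans (∈⇒≤sum p∈xs) (ℕ.m≤n+m (sum xs) x)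

freshVars : (Θ : List Var) (k : ℕ) → ∃ λ F → Unique F × Disjoint Θ F × length F ≡ k
freshVars Θ k =
  applyUpTo (m +_) k ,
  applyUpTo⁺₁ (m +_) k (λ i<j _ → ℕ.<⇒≢ (ℕ.+-monoʳ-< m i<j)) ,
  disjoint ,
  length-applyUpTo (m +_) k
  where
  m = suc (sum Θ)
  disjoint : Disjoint Θ (applyUpTo (m +_) k)
  disjoint (p∈Θ , p∈F) with ∈-applyUpTo⁻ (m +_) p∈F
  ... | i , _ , refl = ℕ.<⇒≱ (ℕ.m≤m+n m i) (∈⇒≤sum p∈Θ)

-- Locality

noStrict-local : ∀ {Φ} ψ → strictCount ψ ≡ 0 → vars ψ ⊆ Φ → Local Φ ψ
noStrict-local {Φ} ψ noStrict ψ⊆Φ Ψ _ _ T = mk⇔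
  (sat-image Ψ Φ (restrictA Ψ Φ) ψ (inj₂ noStrict) agree (image-isImage Ψ Φ (restrictA Ψ Φ) T))
  (sat-preimage Ψ Φ (restrictA Ψ Φ) ψ [] [] (ℕ.≤-reflexive noStrict) agree
    (image-isImage Ψ Φ (restrictA Ψ Φ) T) (λ ()) ∘ sat⇒sat-lax Φ (restrictT Ψ Φ T) ψ)
  where
  agree : AgreesOn Ψ Φ (restrictA Ψ Φ) (vars ψ)
  agree = agreesOn-restrictA Ψ Φ ψ⊆Φ

module _ {Φ : Domain} {φ : Formula} (local : Local Φ φ)
         {Ψ : Domain} (uΨ : Unique Ψ) (φ⊆Ψ : vars φ ⊆ Ψ)
         {Ψ₂ : Domain} (uΨ₂ : Unique Ψ₂) (Ψ⊆Ψ₂ : Ψ ⊆ Ψ₂) (Φ⊆Ψ₂ : Φ ⊆ Ψ₂)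
         {F : List Var} (uF : Unique F) (Ψ₂#F : Disjoint Ψ₂ F)
         (enoughFresh : strictCount φ ≤ length F) where

  private
    Ψ₁ : Domain
    Ψ₁ = Ψ₂ ++ F

    g : Assign Ψ₁ → Assign Ψ₂
    g = restrictA Ψ₁ Ψ₂

    f : Assign Ψ₂ → Assign Ψ
    f = restrictA Ψ₂ Ψ

    extend : Assign Ψ → Assign Ψ₂
    extend t = fromValuation Ψ₂ (val Ψ t)

  sat-lax⇒sat-of-local : (T : Team Ψ) → sat Ψ T (lax φ) → sat Ψ T φ
  sat-lax⇒sat-of-local T T⊨φˡᵃˣ =
    sat-image Ψ₂ Ψ f φ (inj₁ (injectiveOn-image Ψ₂ Ψ extend f∘extend)) (agreesOn-restrictA Ψ₂ Ψ φ⊆Ψ)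
      T₂↠T T₂⊨φ
    where
    f∘extend : ∀ t → f (extend t) ≡ t
    f∘extend = restrictA-extension Ψ₂ Ψ uΨ Ψ⊆Ψ₂

    T₂ : Team Ψ₂
    T₂ = image Ψ Ψ₂ extend T

    T₁ : Team Ψ₁
    T₁ = T₂ ∘ g

    T₂↠T : IsImage Ψ₂ Ψ f T₂ T
    T₂↠T = isImage-image Ψ₂ Ψ extend f∘extend

    T₁↠T₂ : IsImage Ψ₁ Ψ₂ g T₁ T₂
    T₁↠T₂ = isImage-preimage Ψ₁ Ψ₂ (fromValuation Ψ₁ ∘ val Ψ₂) (restrictA-extension Ψ₁ Ψ₂ uΨ₂ ∈-++⁺ˡ)

    T₁⊨φ : sat Ψ₁ T₁ φ
    T₁⊨φ = sat-preimage Ψ₁ Ψ (f ∘ g) φ F uF enoughFresh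
      (agreesOn-∘ Ψ₁ Ψ₂ Ψ (agreesOn-restrictA Ψ₁ Ψ₂ (Ψ⊆Ψ₂ ∘ φ⊆Ψ)) (agreesOn-restrictA Ψ₂ Ψ φ⊆Ψ))
      (isImage-∘ Ψ₁ Ψ₂ Ψ T₁↠T₂ T₂↠T) (free-cylinder Ψ₂ F Ψ f T₂ Ψ₂#F) T⊨φˡᵃˣ

    -- The two restrictions agree only pointwise (no function extensionality),
    -- so φ is carried across by sat-image along id.
    sameRestriction : IsImage Φ Φ id (restrictT Ψ₁ Φ T₁) (restrictT Ψ₂ Φ T₂)
    sameRestriction = isImage-unique Ψ₁ Φ (sym ∘ restrictA-restrictA Ψ₁ Ψ₂ Φ Φ⊆Ψ₂)
      (image-isImage Ψ₁ Φ (restrictA Ψ₁ Φ) T₁)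
      (isImage-∘ Ψ₁ Ψ₂ Φ T₁↠T₂ (image-isImage Ψ₂ Φ (restrictA Ψ₂ Φ) T₂))

    T₂⊨φ : sat Ψ₂ T₂ φ
    T₂⊨φ = Equivalence.from (local Ψ₂ uΨ₂ Φ⊆Ψ₂ T₂)
      (sat-image Φ Φ id φ (inj₁ λ _ _ _ _ → id) (λ _ _ → refl) sameRestriction
        (Equivalence.to (local Ψ₁ (++⁺ uΨ₂ uF Ψ₂#F) (∈-++⁺ˡ ∘ Φ⊆Ψ₂) T₁) T₁⊨φ))

theorem3p16 : (Φ : Domain) → Unique Φ → (φ : Formula) → vars φ ⊆ Φ →
    Local Φ φ ⇔ Equivalent φ (lax φ)
theorem3p16 Φ uΦ φ φ⊆Φ = mk⇔ local⇒equivalent equivalent⇒local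
  where
  lax-⊆ : ∀ {Θ} → vars φ ⊆ Θ → vars (lax φ) ⊆ Θ
  lax-⊆ φ⊆Θ = φ⊆Θ ∘ subst (_ ∈_) (vars-lax φ)

  local⇒equivalent : Local Φ φ → Equivalent φ (lax φ)
  local⇒equivalent local Ψ uΨ φ⊆Ψ _ T with unique-union uΨ uΦ
  ... | Ψ₂ , uΨ₂ , Ψ⊆Ψ₂ , Φ⊆Ψ₂ with freshVars Ψ₂ (strictCount φ)
  ...   | F , uF , Ψ₂#F , |F|≡ =
    mk⇔ (sat⇒sat-lax Ψ T φ)
        (sat-lax⇒sat-of-local local uΨ φ⊆Ψ uΨ₂ Ψ⊆Ψ₂ Φ⊆Ψ₂ uF Ψ₂#F (ℕ.≤-reflexive (sym |F|≡)) T)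

  equivalent⇒local : Equivalent φ (lax φ) → Local Φ φ
  equivalent⇒local equivalent Ψ uΨ Φ⊆Ψ T =
    ⇔.trans (equivalent Ψ uΨ φ⊆Ψ (lax-⊆ φ⊆Ψ) T)
      (⇔.trans (noStrict-local (lax φ) (strictCount-lax φ) (lax-⊆ φ⊆Φ) Ψ uΨ Φ⊆Ψ T)
        (⇔.sym (equivalent Φ uΦ φ⊆Φ (lax-⊆ φ⊆Φ) (restrictT Ψ Φ T))))
    where
    φ⊆Ψ : vars φ ⊆ Ψ
    φ⊆Ψ = Φ⊆Ψ ∘ φ⊆Φ
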